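{- For every diagram $D$, \[\mathrm{MC}(D)=\sum_{(r,c)\in D}\mathrm{room}_D(r,c).\]
   Context: A diagram is a finite subset $D\subset\mathbb{Z}_{>0}\times\mathbb{Z}_{>0}$; an element $(r,c)\in D$ is called a cell in row $r$ and column $c$. For $r\in\mathbb{Z}_{>0}$, the Kohnert move at row $r$ is defined as follows: if row $r$ of $D$ contains no cell, $\mathcal{K}(D,r)=D$; otherwise let $(r,c)$ be the cell of $D$ in row $r$ with the largest column index; if there is some $r'<r$ with $(r',c)\notin D$, let $r'$ be the largest such and set $\mathcal{K}(D,r)=(D\setminus\{(r,c)\})\cup\{(r',c)\}$; otherwise $\mathcal{K}(D,r)=D$. The move is nontrivial if $\mathcal{K}(D,r)\neq D$. Let $\mathrm{KD}(D)$ be the set of diagrams obtainable from $D$ by applying a (possibly empty) finite sequence of Kohnert moves, and $\mathrm{Min}(D)=\{\tilde D\in\mathrm{KD}(D): \mathcal{K}(\tilde D,r)=\tilde D \text{ for all } r\}$. $\mathrm{MC}(D)$ is the maximum, over all $\tilde D\in\mathrm{Min}(D)$, of the number $n$ of moves in a sequence of rows $(r_1,\dots,r_n)$ such that, with $D_0=D$ and $D_i=\mathcal{K}(D_{i-1},r_i)$, every move is nontrivial ($D_{i-1}\neq D_i$) and $D_n=\tilde D$. For a cell $(r,c)\in D$ and $\tilde c>0$, let $\mathrm{blockers}_{D,\tilde c}(r,c)=\{(\tilde r,\tilde c)\in D : \tilde r\le r\}$, and define $\mathrm{room}_D(r,c)=r-\max_{\tilde c\ge c}|\mathrm{blockers}_{D,\tilde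 c}(r,c)|$. -}

module Defs where

open import Data.Nat using (ℕ; zero; suc; _≤_; _<_; _∸_; _⊔_; _≤ᵇ_; _≟_; _≤?_)
open import Data.Nat.Properties using () renaming (_≟_ to _≟ℕ_)
open import Data.Bool using (Bool; true; false; if_then_else_)
open import Data.Product using (_×_; _,_; proj₁; proj₂; ∃-syntax)
open import Data.Product.Properties using (≡-dec)
open import Data.Maybe using (Maybe; just; nothing)
open import Data.List using (List; []; _∷_; map; filter; length; foldr)
open import Data.List.Relation.Unary.All using (All)
open import Data.List.Relation.Unary.Unique.Propositional using (Unique)
open import Data.List.Membership.Propositional using (_∈_)
open import Relation.Nullary using (¬_; Dec; yes; no)
open import Relation.Nullary.Decidable using (_×-dec_; ¬?)
open import Relation.Binary.PropositionalEquality using (_≡_)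
open import Function.Bundles using (_⇔_)
open import Data.Unit using (⊤)

-- A cell (r , c): row r, column c.
Cell : Set
Cell = ℕ × ℕ

_≟c_ : (x y : Cell) → Dec (x ≡ y)
_≟c_ = ≡-dec _≟ℕ_ _≟ℕ_

open import Data.List.Membership.DecPropositional _≟c_ using (_∈?_)

-- A diagram is represented by a duplicate-free list of cells with positive
-- coordinates (a finite subset of ℤ>0 × ℤ>0).
ValidDiagram : List Cell → Set
ValidDiagram D = Unique D × All (λ x → 1 ≤ proj₁ x × 1 ≤ proj₂ x) D

_≋_ : List Cell → List Cell → Set
D ≋ E = ∀ x → (x ∈ D) ⇔ (x ∈ E)

maxColInRow : List Cell → ℕ → Maybe ℕ
maxColInRow D r = go (filter (λ x → proj₁ x ≟ r) D)
  where
  go : List Cell → Maybe ℕ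
  go []       = nothing
  go (x ∷ xs) with go xs
  ... | nothing = just (proj₂ x)
  ... | just m  = just (proj₂ x ⊔ m)

freeRowAtMost : List Cell → ℕ → ℕ → Maybe ℕ
freeRowAtMost D c zero    = nothing
freeRowAtMost D c (suc k) with (suc k , c) ∈? D
... | yes _ = freeRowAtMost D c k
... | no  _ = just (suc k)

kohnert : List Cell → ℕ → List Cell
kohnert D r with maxColInRow D r
... | nothing = D
... | just c with freeRowAtMost D c (r ∸ 1)
...   | nothing = D
...   | just r' = (r' , c) ∷ filter (λ x → ¬? (x ≟c (r , c))) D

applyMoves : List Cell → List ℕ → List Cell
applyMoves D []       = D
applyMoves D (r ∷ rs) = applyMoves (kohnert D r) rs

AllNontrivial : List Cell → List ℕ → Set
AllNontrivial D []       = ⊤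
AllNontrivial D (r ∷ rs) = (¬ (kohnert D r ≋ D)) × AllNontrivial (kohnert D r) rs

IsMinimal : List Cell → Set
IsMinimal E = ∀ r → kohnert E r ≋ E

-- Sequences of nontrivial moves from D ending at a diagram of Min(D).
-- (Any diagram reached by moves lies in KD(D).)
IsMinSequence : List Cell → List ℕ → Set
IsMinSequence D rs = AllNontrivial D rs × IsMinimal (applyMoves D rs)

IsMC : List Cell → ℕ → Set
IsMC D n = (∃[ rs ] (IsMinSequence D rs × length rs ≡ n))
         × (∀ rs → IsMinSequence D rs → length rs ≤ n)

blockers : List Cell → ℕ → ℕ → ℕ
blockers D c̃ r = length (filter (λ y → (proj₂ y ≟ c̃) ×-dec (proj₁ y ≤? r)) D)

-- max over c̃ ≥ c of |blockers_{D,c̃}(r,c)|; columns containing no cell of D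
-- contribute 0, so it suffices to range over columns of cells of D.
maxBlockers : List Cell → Cell → ℕ
maxBlockers D (r , c) =
  foldr _⊔_ 0 (map (λ y → if c ≤ᵇ proj₂ y then blockers D (proj₂ y) r else 0) D)

room : List Cell → Cell → ℕ
room D (r , c) = r ∸ maxBlockers D (r , c)

-- The total room Φ(D) = Σ room_D(x) is a potential for Kohnert moves. A nontrivial move at row r
-- sends the rightmost cell (r, c) of that row to the highest free position (t, c) below it.
-- Blocker counts can only grow, so no cell gains room, and the moved cell loses at least one
-- unit: in every column c̃ ≥ c, D has at most r − t − 1 more blockers up to height r than the
-- new diagram has up to height t, because row r has no cell right of c and the new diagram has
-- the moved cell itself in column c. If moreover every row below r is stuck, the cells below
-- row r have room 0, the cells in rows ≥ r keep their room, and the moved cell loses exactly one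
-- unit: either t = r − 1, or it jumped over a cell of the stuck row r − 1, which caps its room
-- at 1. A diagram in which every row is stuck has Φ = 0. Hence every sequence of nontrivial
-- moves has length at most Φ(D), and always moving in the lowest movable row reaches a
-- minimal diagram after exactly Φ(D) moves.
module Submission where

open import Data.Bool using (true; false; if_then_else_; T)
open import Data.List using (List; []; _∷_; [_]; map; filter; length; foldr)
open import Data.List.Membership.Propositional using (_∈_; _∉_)
open import Data.List.Membership.Propositional.Properties using (∈-filter⁺; ∈-filter⁻; ∈-map⁺; ∈-map⁻)
open import Data.List.Properties
  using (foldr-forcesᵇ; foldr-preservesᵇ; filter-accept; filter-reject; filter-all; filter-none)
open import Data.List.Relation.Binary.Permutation.Propositional
  using (_↭_; ↭-refl; ↭-reflexive; ↭-prep; ↭-swap; module PermutationReasoning)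
open import Data.List.Relation.Binary.Permutation.Propositional.Properties
  using (↭-length; filter-↭; ∈-resp-↭; map⁺)
open import Data.List.Relation.Binary.Sublist.Heterogeneous.Properties using (length-mono-≤)
open import Data.List.Relation.Binary.Sublist.Propositional using (⊆-refl)
open import Data.List.Relation.Binary.Sublist.Propositional.Properties using (filter⁺)
open import Data.List.Relation.Unary.All as All using (All; []; _∷_)
import Data.List.Relation.Unary.All.Properties as All
open import Data.List.Relation.Unary.Any using (here; there)
open import Data.List.Relation.Unary.Unique.Propositional using (Unique; _∷_)
import Data.List.Relation.Unary.Unique.Propositional.Properties as Unique
open import Data.Maybe using (Maybe; just; nothing)
open import Data.Nat
  using (ℕ; zero; suc; _+_; _∸_; _⊔_; _≤_; _<_; _≤ᵇ_; z≤n; s≤s; z<s; >-nonZero)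
open import Data.Nat.ListAction using (sum)
open import Data.Nat.ListAction.Properties using (sum-↭)
open import Data.Nat.Properties
open import Data.Product using (Σ-syntax; ∃-syntax; _×_; _,_; proj₁; proj₂)
open import Data.Sum using (_⊎_; inj₁; inj₂; [_,_]′)
open import Data.Unit using (tt)
open import Function using (_∘_; id)
open import Function.Bundles using (Equivalence)
open import Function.Construct.Identity using (⇔-id)
open import Level using (0ℓ)
open import Relation.Binary.Definitions using (DecidableEquality)
open import Relation.Binary.PropositionalEquality
  using (_≡_; _≢_; refl; sym; trans; cong; cong₂; subst; ≢-sym; module ≡-Reasoning)
open import Relation.Nullary using (¬_; Dec; yes; no; does; contradiction)
open import Relation.Nullary.Decidable using (¬?; _×-dec_)
open import Relation.Unary using (Pred; Decidable)

open import Defs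
open import Data.List.Membership.DecPropositional _≟c_ using (_∈?_)

interval-suc : ∀ {P : ℕ → Set} {l n} → P (suc n) → (∀ {i} → l ≤ i → i ≤ n → P i) →
               ∀ {i} → l ≤ i → i ≤ suc n → P i
interval-suc top below l≤i i≤1+n with m≤n⇒m<n∨m≡n i≤1+n
... | inj₁ i<1+n = below l≤i (≤-pred i<1+n)
... | inj₂ refl  = top

lowest-or-all : ∀ {P Q : ℕ → Set} → (∀ n → P n ⊎ Q n) → ∀ n →
                (∀ {i} → i < n → P i) ⊎ ∃[ i ] ((∀ {k} → k < i → P k) × Q i)
lowest-or-all P⊎Q zero    = inj₁ λ ()
lowest-or-all P⊎Q (suc n) with lowest-or-all P⊎Q n
... | inj₂ lowest = inj₂ lowest
... | inj₁ below with P⊎Q n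
...   | inj₁ pn = inj₁ (λ i<1+n → [ below , (λ { refl → pn }) ]′ (m<1+n⇒m<n∨m≡n i<1+n))
...   | inj₂ qn = inj₂ (n , below , qn)

module Remove {A : Set} (_≟_ : DecidableEquality A) where

  remove : A → List A → List A
  remove x = filter (λ y → ¬? (y ≟ x))

  ∉-remove : ∀ {x} xs → x ∉ remove x xs
  ∉-remove {x} xs x∈ = proj₂ (∈-filter⁻ (λ y → ¬? (y ≟ x)) {xs = xs} x∈) refl

  ∈-remove⁻ : ∀ {x y} xs → y ∈ remove x xs → y ∈ xs
  ∈-remove⁻ {x} xs y∈ = proj₁ (∈-filter⁻ (λ y → ¬? (y ≟ x)) {xs = xs} y∈)

  remove-unique : ∀ {x xs} → Unique xs → Unique (remove x xs)
  remove-unique {x} = Unique.filter⁺ (λ y → ¬? (y ≟ x))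

  ↭-remove : ∀ {x xs} → Unique xs → x ∈ xs → xs ↭ x ∷ remove x xs
  ↭-remove {x} {x ∷ xs} (x∉xs ∷ _) (here refl) = ↭-reflexive (cong (x ∷_) (sym (begin
    remove x (x ∷ xs) ≡⟨ filter-reject (λ y → ¬? (y ≟ x)) (λ x≢x → x≢x refl) ⟩
    remove x xs       ≡⟨ filter-all (λ y → ¬? (y ≟ x)) (All.map ≢-sym x∉xs) ⟩
    xs                ∎)))
    where open ≡-Reasoning
  ↭-remove {x} {y ∷ xs} (y∉xs ∷ u) (there x∈) = begin
    y ∷ xs                ↭⟨ ↭-prep y (↭-remove u x∈) ⟩
    y ∷ x ∷ remove x xs   ↭⟨ ↭-swap y x ↭-refl ⟩
    x ∷ y ∷ remove x xs   ≡⟨ cong (x ∷_) (filter-accept (λ z → ¬? (z ≟ x)) (All.lookup y∉xs x∈)) ⟨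
    x ∷ remove x (y ∷ xs) ∎
    where open PermutationReasoning

open Remove _≟c_

length-filter-∷ : ∀ {A : Set} {P : Pred A 0ℓ} (P? : Decidable P) x xs →
                  length (filter P? (x ∷ xs)) ≡ length (filter P? [ x ]) + length (filter P? xs)
length-filter-∷ P? x xs with does (P? x)
... | true  = refl
... | false = refl

module _ {A : Set} (g : A → ℕ) where

  ≤-foldr-⊔ : ∀ {y xs} → y ∈ xs → g y ≤ foldr _⊔_ 0 (map g xs)
  ≤-foldr-⊔ {xs = xs} y∈ = All.lookup
    (foldr-forcesᵇ {P = _≤ foldr _⊔_ 0 (map g xs)}
                   (λ m n m⊔n≤ → m⊔n≤o⇒m≤o m n m⊔n≤ , m⊔n≤o⇒n≤o m n m⊔n≤)
                   0 (map g xs) ≤-refl)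
    (∈-map⁺ g y∈)

  foldr-⊔-lub : ∀ {m xs} → (∀ {y} → y ∈ xs → g y ≤ m) → foldr _⊔_ 0 (map g xs) ≤ m
  foldr-⊔-lub {m} ≤m = foldr-preservesᵇ {P = _≤ m} ⊔-lub z≤n (All.map⁺ (All.tabulate ≤m))

module _ {A : Set} {f g : A → ℕ} where

  sum-map-mono : ∀ {xs} → (∀ {x} → x ∈ xs → f x ≤ g x) → sum (map f xs) ≤ sum (map g xs)
  sum-map-mono {[]}     _   = z≤n
  sum-map-mono {x ∷ xs} f≤g = +-mono-≤ (f≤g (here refl)) (sum-map-mono (f≤g ∘ there))

module _ {A : Set} {f : A → ℕ} where

  sum-map-zero : ∀ {xs} → (∀ {x} → x ∈ xs → f x ≡ 0) → sum (map f xs) ≡ 0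
  sum-map-zero {[]}     _    = refl
  sum-map-zero {x ∷ xs} f≡0 = cong₂ _+_ (f≡0 (here refl)) (sum-map-zero (f≡0 ∘ there))

suc[t∸m']≤suc[t+g]∸m : ∀ {t g m m'} → m' ≤ t → m ≤ m' + g → suc (t ∸ m') ≤ suc (t + g) ∸ m
suc[t∸m']≤suc[t+g]∸m {t} {g} {m} {m'} m'≤t m≤m'+g = begin
  suc (t ∸ m')           ≡⟨ +-∸-assoc 1 m'≤t ⟨
  suc t ∸ m'             ≡⟨ [m+n]∸[m+o]≡n∸o g (suc t) m' ⟨
  (g + suc t) ∸ (g + m') ≡⟨ cong₂ _∸_ (+-comm g (suc t)) (+-comm g m') ⟩
  suc (t + g) ∸ (m' + g) ≤⟨ ∸-monoʳ-≤ (suc (t + g)) m≤m'+g ⟩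
  suc (t + g) ∸ m        ∎
  where open ≤-Reasoning

-- Rows and columns

rowOf : (r : ℕ) (x : Cell) → Dec (proj₁ x ≡ r)
rowOf r x = proj₁ x ≟ r

data IsMaximum (ns : List ℕ) : Maybe ℕ → Set where
  empty    : ns ≡ [] → IsMaximum ns nothing
  attained : ∀ {m} → m ∈ ns → All (_≤ m) ns → IsMaximum ns (just m)

-- `maxColInRow` scans the row with a function local to its definition; unification recovers
-- that function so that it can be reasoned about by induction.
rowScan : (D : List Cell) (r : ℕ) →
          Σ[ scan ∈ (List Cell → Maybe ℕ) ] scan (filter (rowOf r) D) ≡ maxColInRow D r
rowScan D r = scan , scan-row
  where
  scan : List Cell → Maybe ℕ
  scan = _
  scan-row : scan (filter (rowOf r) D) ≡ maxColInRow D r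
  scan-row with filter (rowOf r) D
  ... | _ = refl

module _ (D : List Cell) (r : ℕ) where

  private
    scan : List Cell → Maybe ℕ
    scan = proj₁ (rowScan D r)

  scan-isMaximum : ∀ L → IsMaximum (map proj₂ L) (scan L)
  scan-isMaximum []            = empty refl
  scan-isMaximum ((p , q) ∷ L) with scan L | scan-isMaximum L
  ... | nothing | empty L≡[]     = attained (here refl) (≤-refl ∷ subst (All (_≤ q)) (sym L≡[]) [])
  ... | just m  | attained m∈ ≤m =
    attained (⊔∈ (⊔-sel q m)) (m≤m⊔n q m ∷ All.map (λ k≤m → ≤-trans k≤m (m≤n⊔m q m)) ≤m)
    where
    ⊔∈ : (q ⊔ m ≡ q) ⊎ (q ⊔ m ≡ m) → q ⊔ m ∈ q ∷ map proj₂ L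
    ⊔∈ (inj₁ q⊔m≡q) = here q⊔m≡q
    ⊔∈ (inj₂ q⊔m≡m) = there (subst (_∈ map proj₂ L) (sym q⊔m≡m) m∈)

data RowMaximum (D : List Cell) (r : ℕ) : Maybe ℕ → Set where
  empty-row    : (∀ {b} → (r , b) ∉ D) → RowMaximum D r nothing
  rightmost-at : ∀ {c} → (r , c) ∈ D → (∀ {b} → (r , b) ∈ D → b ≤ c) → RowMaximum D r (just c)

maxColInRow-spec : ∀ D r → RowMaximum D r (maxColInRow D r)
maxColInRow-spec D r =
  subst (RowMaximum D r) (proj₂ (rowScan D r)) (fromRow (scan-isMaximum D r (filter (rowOf r) D)))
  where
  inRow : ∀ {b} → (r , b) ∈ D → b ∈ map proj₂ (filter (rowOf r) D)
  inRow rb∈ = ∈-map⁺ proj₂ (∈-filter⁺ (rowOf r) rb∈ refl)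
  fromRow : ∀ {m} → IsMaximum (map proj₂ (filter (rowOf r) D)) m → RowMaximum D r m
  fromRow (empty row≡[]) = empty-row (λ rb∈ → contradiction (subst (_ ∈_) row≡[] (inRow rb∈)) λ ())
  fromRow (attained m∈ ≤m) with ∈-map⁻ proj₂ m∈
  ... | y , y∈ , refl with ∈-filter⁻ (rowOf r) y∈
  ...   | y∈D , refl = rightmost-at y∈D (λ rb∈ → All.lookup ≤m (inRow rb∈))

ColumnFull : List Cell → ℕ → ℕ → Set
ColumnFull D c a = ∀ {i} → 1 ≤ i → i ≤ a → (i , c) ∈ D

column-full-extend : ∀ {D c r} → (r , c) ∈ D → ColumnFull D c (r ∸ 1) → ColumnFull D c r
column-full-extend {r = zero}  _   _     1≤i i≤0 = contradiction (≤-trans 1≤i i≤0) λ ()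
column-full-extend {r = suc _} top below         = interval-suc top below

data FreeRow (D : List Cell) (c k : ℕ) : Maybe ℕ → Set where
  full    : ColumnFull D c k → FreeRow D c k nothing
  highest : ∀ {t} → 1 ≤ t → t ≤ k → (t , c) ∉ D →
            (∀ {i} → t < i → i ≤ k → (i , c) ∈ D) → FreeRow D c k (just t)

freeRowAtMost-spec : ∀ D c k → FreeRow D c k (freeRowAtMost D c k)
freeRowAtMost-spec D c zero    = full (λ 1≤i i≤0 → contradiction (≤-trans 1≤i i≤0) λ ())
freeRowAtMost-spec D c (suc k) with (suc k , c) ∈? D
... | no top∉ = highest (s≤s z≤n) ≤-refl top∉ (λ k<i i≤k → contradiction (≤-trans k<i i≤k) 1+n≰n)
... | yes top∈ with freeRowAtMost D c k | freeRowAtMost-spec D c k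
...   | nothing | full below = full (interval-suc top∈ below)
...   | just t  | highest 1≤t t≤k t∉ above =
  highest 1≤t (m≤n⇒m≤1+n t≤k) t∉ (interval-suc top∈ above)

-- Blockers

blocks? : (j a : ℕ) (y : Cell) → Dec (proj₂ y ≡ j × proj₁ y ≤ a)
blocks? j a y = (proj₂ y ≟ j) ×-dec (proj₁ y ≤? a)

module _ {j a : ℕ} where

  blockers-∷ : ∀ y L → blockers (y ∷ L) j a ≡ blockers [ y ] j a + blockers L j a
  blockers-∷ = length-filter-∷ (blocks? j a)

  blockers-↭ : ∀ {L L'} → L ↭ L' → blockers L j a ≡ blockers L' j a
  blockers-↭ L↭L' = ↭-length (filter-↭ (blocks? j a) L↭L')

  blockers-mono : ∀ {L a'} → a ≤ a' → blockers L j a ≤ blockers L j a'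
  blockers-mono {L} {a'} a≤a' = length-mono-≤ (filter⁺ (blocks? j a) (blocks? j a')
    (λ { refl (q≡j , p≤a) → q≡j , ≤-trans p≤a a≤a' }) (⊆-refl {x = L}))

  blockers-single≡1 : ∀ {p} → p ≤ a → blockers [ (p , j) ] j a ≡ 1
  blockers-single≡1 p≤a = cong length (filter-accept (blocks? j a) (refl , p≤a))

  blockers-single≡0 : ∀ y → ¬ (proj₂ y ≡ j × proj₁ y ≤ a) → blockers [ y ] j a ≡ 0
  blockers-single≡0 _ ¬blocks = cong length (filter-reject (blocks? j a) ¬blocks)

  blockers-single-≤ : ∀ {p p'} q → p' ≤ p → blockers [ (p , q) ] j a ≤ blockers [ (p' , q) ] j a
  blockers-single-≤ {p} {p'} q p'≤p with blocks? j a (p , q)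
  ... | yes (refl , p≤a) =
    ≤-reflexive (trans (blockers-single≡1 p≤a) (sym (blockers-single≡1 (≤-trans p'≤p p≤a))))
  ... | no ¬blocks       = ≤-trans (≤-reflexive (blockers-single≡0 (p , q) ¬blocks)) z≤n

blockers-single-≡ : ∀ {j a a' p p'} q → p ≤ a → p' ≤ a' →
                    blockers [ (p , q) ] j a ≡ blockers [ (p' , q) ] j a'
blockers-single-≡ {j} {p = p} {p'} q p≤a p'≤a' with q ≟ j
... | yes refl = trans (blockers-single≡1 {j} p≤a) (sym (blockers-single≡1 {j} p'≤a'))
... | no q≢j   =
  trans (blockers-single≡0 (p , q) (q≢j ∘ proj₁)) (sym (blockers-single≡0 (p' , q) (q≢j ∘ proj₁)))

blockers-single-suc : ∀ {j h y} → y ≢ (suc h , j) → blockers [ y ] j (suc h) ≡ blockers [ y ] j h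
blockers-single-suc {j} {h} {p , q} y≢top with p ≤? h
... | yes p≤h = blockers-single-≡ q (m≤n⇒m≤1+n p≤h) p≤h
... | no  p≰h = trans (blockers-single≡0 (p , q) ¬blocks) (sym (blockers-single≡0 (p , q) (p≰h ∘ proj₂)))
  where
  ¬blocks : ¬ (q ≡ j × p ≤ suc h)
  ¬blocks (refl , p≤1+h) = y≢top (cong (_, q) (≤-antisym p≤1+h (≰⇒> p≰h)))

module _ {j h : ℕ} where

  blockers-suc-∉ : ∀ {L} → (suc h , j) ∉ L → blockers L j (suc h) ≡ blockers L j h
  blockers-suc-∉ {[]}    _    = refl
  blockers-suc-∉ {y ∷ L} top∉ = begin
    blockers (y ∷ L) j (suc h)                      ≡⟨ blockers-∷ y L ⟩
    blockers [ y ] j (suc h) + blockers L j (suc h) ≡⟨ cong₂ _+_ (blockers-single-suc (top∉ ∘ here ∘ sym))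
                                                                 (blockers-suc-∉ (top∉ ∘ there)) ⟩
    blockers [ y ] j h + blockers L j h             ≡⟨ blockers-∷ y L ⟨
    blockers (y ∷ L) j h                            ∎
    where open ≡-Reasoning

  blockers-suc-∈ : ∀ {L} → Unique L → (suc h , j) ∈ L → blockers L j (suc h) ≡ suc (blockers L j h)
  blockers-suc-∈ {L} u top∈ = begin
    blockers L j (suc h)                                ≡⟨ blockers-↭ L↭ ⟩
    blockers (top ∷ S) j (suc h)                        ≡⟨ blockers-∷ top S ⟩
    blockers [ top ] j (suc h) + blockers S j (suc h)   ≡⟨ cong₂ _+_ (blockers-single≡1 {j} ≤-refl)
                                                                     (blockers-suc-∉ (∉-remove L)) ⟩
    suc (blockers S j h)                                ≡⟨ cong (λ n → suc (n + blockers S j h))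
                                                                (blockers-single≡0 top (1+n≰n ∘ proj₂)) ⟨
    suc (blockers [ top ] j h + blockers S j h)         ≡⟨ cong suc (blockers-∷ top S) ⟨
    suc (blockers (top ∷ S) j h)                        ≡⟨ cong suc (blockers-↭ L↭) ⟨
    suc (blockers L j h)                                ∎
    where
    open ≡-Reasoning
    top = (suc h , j)
    S   = remove top L
    L↭ : L ↭ top ∷ S
    L↭ = ↭-remove u top∈

Positive : List Cell → Set
Positive D = All (λ x → 1 ≤ proj₁ x × 1 ≤ proj₂ x) D

module _ {L : List Cell} {j : ℕ} where

  blockers-suc≤ : ∀ {h} → Unique L → blockers L j (suc h) ≤ suc (blockers L j h)
  blockers-suc≤ {h} u with (suc h , j) ∈? L
  ... | yes top∈ = ≤-reflexive (blockers-suc-∈ u top∈)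
  ... | no  top∉ = ≤-trans (≤-reflexive (blockers-suc-∉ top∉)) (n≤1+n _)

  blockers-+ : ∀ {a} k → Unique L → blockers L j (a + k) ≤ blockers L j a + k
  blockers-+ {a} zero    _ = ≤-reflexive (trans (cong (blockers L j) (+-identityʳ a)) (sym (+-identityʳ _)))
  blockers-+ {a} (suc k) u = begin
    blockers L j (a + suc k)   ≡⟨ cong (blockers L j) (+-suc a k) ⟩
    blockers L j (suc (a + k)) ≤⟨ blockers-suc≤ u ⟩
    suc (blockers L j (a + k)) ≤⟨ s≤s (blockers-+ k u) ⟩
    suc (blockers L j a + k)   ≡⟨ +-suc _ k ⟨
    blockers L j a + suc k     ∎
    where open ≤-Reasoning

  blockers-zero : Positive L → blockers L j 0 ≡ 0
  blockers-zero pos = cong length (filter-none (blocks? j 0)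
    (All.map (λ (1≤p , _) (_ , p≤0) → contradiction (≤-trans 1≤p p≤0) λ ()) pos))

  blockers≤ : ∀ {a} → ValidDiagram L → blockers L j a ≤ a
  blockers≤ {a} (u , pos) = ≤-trans (blockers-+ {0} a u) (≤-reflexive (cong (_+ a) (blockers-zero pos)))

  column-full⇒≤blockers : ∀ {a} → Unique L → ColumnFull L j a → a ≤ blockers L j a
  column-full⇒≤blockers {zero}  _ _      = z≤n
  column-full⇒≤blockers {suc a} u filled = begin
    suc a                ≤⟨ s≤s (column-full⇒≤blockers u (λ 1≤i → filled 1≤i ∘ m≤n⇒m≤1+n)) ⟩
    suc (blockers L j a) ≡⟨ blockers-suc-∈ u (filled (s≤s z≤n) ≤-refl) ⟨
    blockers L j (suc a) ∎
    where open ≤-Reasoning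

module _ {D : List Cell} {a c : ℕ} where

  private
    candidate : Cell → ℕ
    candidate y = if c ≤ᵇ proj₂ y then blockers D (proj₂ y) a else 0

  blockers≤maxBlockers : ∀ {i j} → (i , j) ∈ D → c ≤ j → blockers D j a ≤ maxBlockers D (a , c)
  blockers≤maxBlockers {j = j} y∈ c≤j = ≤-trans (≤candidate (≤⇒≤ᵇ c≤j)) (≤-foldr-⊔ candidate y∈)
    where
    ≤candidate : T (c ≤ᵇ j) → blockers D j a ≤ (if c ≤ᵇ j then blockers D j a else 0)
    ≤candidate _ with c ≤ᵇ j
    ... | true = ≤-refl

  maxBlockers-lub : ∀ {m} → (∀ {i j} → (i , j) ∈ D → c ≤ j → blockers D j a ≤ m) →
                    maxBlockers D (a , c) ≤ m
  maxBlockers-lub {m} ≤m = foldr-⊔-lub candidate λ {(i , j)} y∈ → candidate≤ (≤m y∈ ∘ ≤ᵇ⇒≤ c j)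
    where
    candidate≤ : ∀ {j} → (T (c ≤ᵇ j) → blockers D j a ≤ m) →
                 (if c ≤ᵇ j then blockers D j a else 0) ≤ m
    candidate≤ {j} ≤m with c ≤ᵇ j
    ... | true  = ≤m _
    ... | false = z≤n

maxBlockers-mono : ∀ {L L' a a' c} → (∀ {i j} → (i , j) ∈ L → ∃[ i' ] (i' , j) ∈ L') →
                   (∀ j → blockers L j a ≤ blockers L' j a') → maxBlockers L (a , c) ≤ maxBlockers L' (a' , c)
maxBlockers-mono {L} {L'} {a} {a'} {c} columns ≤blockers = maxBlockers-lub {L} {a} {c} λ y∈ c≤j →
  ≤-trans (≤blockers _) (blockers≤maxBlockers {L'} {a'} (proj₂ (columns y∈)) c≤j)

maxBlockers≤ : ∀ {D a c} → ValidDiagram D → maxBlockers D (a , c) ≤ a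
maxBlockers≤ {D} {a} {c} v = maxBlockers-lub {D} {a} {c} (λ {_} {j} _ _ → blockers≤ {D} {j} v)

-- Stuck rows

Stuck : List Cell → ℕ → Set
Stuck D r = ∀ {b} → (r , b) ∈ D → ∃[ c ] (b ≤ c × ColumnFull D c r)

stuck⇒≤maxBlockers : ∀ {D a a' b} → Unique D → Stuck D a → (a , b) ∈ D → a ≤ a' →
                     a ≤ maxBlockers D (a' , b)
stuck⇒≤maxBlockers {a = zero} _ _ _ _ = z≤n
stuck⇒≤maxBlockers {D} {suc a} {a'} {b} u stuck ab∈ a≤a' with stuck ab∈
... | c , b≤c , filled = begin
  suc a                  ≤⟨ column-full⇒≤blockers u filled ⟩
  blockers D c (suc a)   ≤⟨ blockers-mono {c} {suc a} {D} a≤a' ⟩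
  blockers D c a'        ≤⟨ blockers≤maxBlockers (filled (s≤s z≤n) ≤-refl) b≤c ⟩
  maxBlockers D (a' , b) ∎
  where open ≤-Reasoning

room-stuck≡0 : ∀ {D a b} → Unique D → Stuck D a → (a , b) ∈ D → room D (a , b) ≡ 0
room-stuck≡0 u stuck ab∈ = m≤n⇒m∸n≡0 (stuck⇒≤maxBlockers u stuck ab∈ ≤-refl)

totalRoom : List Cell → ℕ
totalRoom D = sum (map (room D) D)

totalRoom-stuck≡0 : ∀ {D} → Unique D → (∀ r → Stuck D r) → totalRoom D ≡ 0
totalRoom-stuck≡0 {D} u stuck = sum-map-zero {xs = D} (λ {(a , _)} ab∈ → room-stuck≡0 u (stuck a) ab∈)

-- One Kohnert move

-- The rightmost cell (r, column) of row r drops to the free position (target, column),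
-- jumping over the `gap` cells of the column strictly between the two.
record Move (D : List Cell) (r : ℕ) : Set where
  field
    column target gap : ℕ
    row≡      : r ≡ suc (target + gap)
    source∈   : (r , column) ∈ D
    rightmost : ∀ {b} → (r , b) ∈ D → b ≤ column
    target≥1  : 1 ≤ target
    target∉   : (target , column) ∉ D
    gap-full  : ∀ {i} → target < i → i ≤ target + gap → (i , column) ∈ D

  source moved : Cell
  source = (r , column)
  moved  = (target , column)

  rest after : List Cell
  rest  = remove source D
  after = moved ∷ rest

-- Indexed by the result of the move, so that matching on `kohnertView D r` computes `kohnert D r`.
data KohnertView (D : List Cell) (r : ℕ) : List Cell → Set where
  fixed : Stuck D r → KohnertView D r D
  moves : (m : Move D r) → KohnertView D r (Move.after m)

kohnertView : ∀ D r → KohnertView D r (kohnert D r)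
kohnertView D r with maxColInRow D r | maxColInRow-spec D r
... | nothing | empty-row r∉ = fixed (λ rb∈ → contradiction rb∈ r∉)
... | just c  | rightmost-at rc∈ ≤c with freeRowAtMost D c (r ∸ 1) | freeRowAtMost-spec D c (r ∸ 1)
...   | nothing | full below = fixed (λ rb∈ → c , ≤c rb∈ , column-full-extend rc∈ below)
...   | just t  | highest 1≤t t≤r∸1 t∉ above = moves (record
  { column = c ; target = t ; gap = r ∸ 1 ∸ t ; row≡ = row≡ ; source∈ = rc∈ ; rightmost = ≤c
  ; target≥1 = 1≤t ; target∉ = t∉ ; gap-full = λ {i} t<i i≤ → above t<i (subst (i ≤_) gap≡ i≤) })
  where
  gap≡ : t + (r ∸ 1 ∸ t) ≡ r ∸ 1
  gap≡ = m+[n∸m]≡n t≤r∸1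
  row≡ : r ≡ suc (t + (r ∸ 1 ∸ t))
  row≡ = trans (sym (suc-pred r {{>-nonZero (≤-trans 1≤t (≤pred⇒≤ t≤r∸1))}})) (cong suc (sym gap≡))

Fixed : List Cell → ℕ → Set
Fixed D r = kohnert D r ≡ D × Stuck D r

Moves : List Cell → ℕ → Set
Moves D r = Σ[ m ∈ Move D r ] kohnert D r ≡ Move.after m

fixed⊎moves : ∀ D r → Fixed D r ⊎ Moves D r
fixed⊎moves D r = classify (kohnertView D r) refl
  where
  classify : ∀ {K} → KohnertView D r K → K ≡ kohnert D r → Fixed D r ⊎ Moves D r
  classify (fixed stuck) D≡    = inj₁ (sym D≡ , stuck)
  classify (moves m)     after≡ = inj₂ (m , sym after≡)

module MoveAnalysis {D : List Cell} {r : ℕ} (v : ValidDiagram D) (m : Move D r) where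

  open Move m public

  D↭ : D ↭ source ∷ rest
  D↭ = ↭-remove (proj₁ v) source∈

  target<r : target < r
  target<r = subst (target <_) (sym row≡) (s≤s (m≤m+n target gap))

  after-valid : ValidDiagram after
  after-valid =
      All.tabulate (λ y∈ moved≡y → target∉ (subst (_∈ D) (sym moved≡y) (∈-remove⁻ D y∈)))
      ∷ remove-unique (proj₁ v)
    , (target≥1 , proj₂ (All.lookup (proj₂ v) source∈)) ∷ All.filter⁺ _ (proj₂ v)

  after≉D : ¬ (after ≋ D)
  after≉D after≋D = target∉ (Equivalence.to (after≋D moved) (here refl))

  column-in-after : ∀ {i j} → (i , j) ∈ D → ∃[ i' ] (i' , j) ∈ after
  column-in-after y∈ with ∈-resp-↭ D↭ y∈
  ... | here refl    = target , here refl
  ... | there y∈rest = _ , there y∈rest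

  column-in-D : ∀ {i j} → (i , j) ∈ after → ∃[ i' ] (i' , j) ∈ D
  column-in-D (here refl) = r , source∈
  column-in-D (there y∈)  = _ , ∈-remove⁻ D y∈

  blockers-D≡ : ∀ j a → blockers D j a ≡ blockers [ source ] j a + blockers rest j a
  blockers-D≡ j a = trans (blockers-↭ D↭) (blockers-∷ source rest)

  blockers≤blockers-after : ∀ j a → blockers D j a ≤ blockers after j a
  blockers≤blockers-after j a = begin
    blockers D j a                              ≡⟨ blockers-D≡ j a ⟩
    blockers [ source ] j a + blockers rest j a ≤⟨ +-monoˡ-≤ _ (blockers-single-≤ {j} {a} column
                                                                                  (<⇒≤ target<r)) ⟩
    blockers [ moved ] j a + blockers rest j a  ≡⟨ blockers-∷ moved rest ⟨
    blockers after j a                          ∎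
    where open ≤-Reasoning

  blockers-after≡ : ∀ j a → r ≤ a → blockers after j a ≡ blockers D j a
  blockers-after≡ j a r≤a = begin
    blockers after j a                          ≡⟨ blockers-∷ moved rest ⟩
    blockers [ moved ] j a + blockers rest j a  ≡⟨ cong (_+ blockers rest j a)
                                                       (blockers-single-≡ {j} column (≤-trans (<⇒≤ target<r) r≤a)
                                                                                     r≤a) ⟩
    blockers [ source ] j a + blockers rest j a ≡⟨ blockers-D≡ j a ⟨
    blockers D j a                              ∎
    where open ≡-Reasoning

  blockers-after-target≤ : ∀ j → blockers after j target ≤ blockers D j r
  blockers-after-target≤ j = begin
    blockers after j target                              ≡⟨ blockers-∷ moved rest ⟩
    blockers [ moved ] j target + blockers rest j target
      ≤⟨ +-mono-≤ (≤-reflexive (blockers-single-≡ {j} column ≤-refl ≤-refl))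
                  (blockers-mono {j} {target} {rest} (<⇒≤ target<r)) ⟩
    blockers [ source ] j r + blockers rest j r          ≡⟨ blockers-D≡ j r ⟨
    blockers D j r                                       ∎
    where open ≤-Reasoning

  blockers-after-column : blockers after column target ≡ suc (blockers D column target)
  blockers-after-column = begin
    blockers after column target                ≡⟨ blockers-∷ moved rest ⟩
    blockers [ moved ] column target + B        ≡⟨ cong (_+ B) (blockers-single≡1 {column} ≤-refl) ⟩
    suc B                                       ≡⟨ cong (λ n → suc (n + B))
                                                        (blockers-single≡0 source (<⇒≱ target<r ∘ proj₂)) ⟨
    suc (blockers [ source ] column target + B) ≡⟨ cong suc (blockers-D≡ column target) ⟨
    suc (blockers D column target)              ∎
    where
    open ≡-Reasoning
    B = blockers rest column target

  room-after≤room : ∀ y → room after y ≤ room D y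
  room-after≤room (a , b) =
    ∸-monoʳ-≤ a (maxBlockers-mono {D} {after} {a} {a} {b} column-in-after
                                  (λ j → blockers≤blockers-after j a))

  room≤room-after-high : ∀ {a b} → r ≤ a → room D (a , b) ≤ room after (a , b)
  room≤room-after-high {a} {b} r≤a =
    ∸-monoʳ-≤ a (maxBlockers-mono {after} {D} {a} {a} {b} column-in-D
                                  (λ j → ≤-reflexive (blockers-after≡ j a r≤a)))

  -- Row r has no cell right of the source, so only column `column` can gain a blocker in row r.
  blockers-source≤ : ∀ {j} → column ≤ j → blockers D j r ≤ blockers after j target + gap
  blockers-source≤ {j} column≤j with column ≟ j
  ... | yes refl = begin
    blockers D column r                    ≡⟨ cong (blockers D column) row≡ ⟩
    blockers D column (suc (target + gap)) ≤⟨ blockers-suc≤ (proj₁ v) ⟩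
    suc (blockers D column (target + gap)) ≤⟨ s≤s (blockers-+ gap (proj₁ v)) ⟩
    suc (blockers D column target + gap)   ≡⟨ cong (_+ gap) blockers-after-column ⟨
    blockers after column target + gap     ∎
    where open ≤-Reasoning
  ... | no column≢j = begin
    blockers D j r                    ≡⟨ cong (blockers D j) row≡ ⟩
    blockers D j (suc (target + gap)) ≡⟨ blockers-suc-∉ right-of-source ⟩
    blockers D j (target + gap)       ≤⟨ blockers-+ gap (proj₁ v) ⟩
    blockers D j target + gap         ≤⟨ +-monoˡ-≤ gap (blockers≤blockers-after j target) ⟩
    blockers after j target + gap     ∎
    where
    open ≤-Reasoning
    right-of-source : (suc (target + gap) , j) ∉ D
    right-of-source rj∈ =
      <⇒≱ (≤∧≢⇒< column≤j column≢j) (rightmost (subst (λ r' → (r' , j) ∈ D) (sym row≡) rj∈))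

  maxBlockers-source≤ : maxBlockers D source ≤ maxBlockers after moved + gap
  maxBlockers-source≤ = maxBlockers-lub {D} {r} {column} λ y∈ column≤j →
    ≤-trans (blockers-source≤ column≤j)
            (+-monoˡ-≤ gap (blockers≤maxBlockers {after} {target} (proj₂ (column-in-after y∈)) column≤j))

  room-moved<room-source : room after moved < room D source
  room-moved<room-source = subst (λ r' → suc (room after moved) ≤ r' ∸ maxBlockers D source) (sym row≡)
    (suc[t∸m']≤suc[t+g]∸m (maxBlockers≤ {after} {target} {column} after-valid) maxBlockers-source≤)

  totalRoom-D≡ : totalRoom D ≡ room D source + sum (map (room D) rest)
  totalRoom-D≡ = sum-↭ (map⁺ (room D) D↭)

  totalRoom-after<totalRoom : totalRoom after < totalRoom D
  totalRoom-after<totalRoom = begin-strict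
    room after moved + sum (map (room after) rest) <⟨ +-mono-<-≤ room-moved<room-source
                                                         (sum-map-mono {xs = rest} (λ {y} _ → room-after≤room y)) ⟩
    room D source + sum (map (room D) rest)        ≡⟨ totalRoom-D≡ ⟨
    totalRoom D                                    ∎
    where open ≤-Reasoning

  module Lowest (below-stuck : ∀ {a} → a < r → Stuck D a) where

    room-source≤ : room D source ≤ suc (room after moved)
    room-source≤ = by-gap gap row≡ gap-full
      where
      M M' : ℕ
      M  = maxBlockers D source
      M' = maxBlockers after moved

      by-gap : ∀ g → r ≡ suc (target + g) →
               (∀ {i} → target < i → i ≤ target + g → (i , column) ∈ D) → r ∸ M ≤ suc (target ∸ M')
      by-gap zero r≡ _ = begin
        r ∸ M             ≤⟨ ∸-monoʳ-≤ r (maxBlockers-mono {after} {D} {target} {r} {column}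
                                                          column-in-D blockers-after-target≤) ⟩
        r ∸ M'            ≡⟨ cong (_∸ M') (trans r≡ (cong suc (+-identityʳ target))) ⟩
        suc target ∸ M'   ≡⟨ +-∸-assoc 1 (maxBlockers≤ {after} {target} {column} after-valid) ⟩
        suc (target ∸ M') ∎
        where open ≤-Reasoning
      -- The moved cell jumped over the cell of the stuck row r − 1 in its column.
      by-gap (suc g) r≡ filled = begin
        r ∸ M             ≤⟨ ∸-monoʳ-≤ r r₀≤M ⟩
        r ∸ r₀            ≡⟨ cong (_∸ r₀) r≡ ⟩
        suc r₀ ∸ r₀       ≡⟨ m+n∸n≡m 1 r₀ ⟩
        1                 ≤⟨ s≤s z≤n ⟩
        suc (target ∸ M') ∎
        where
        open ≤-Reasoning
        r₀ : ℕ
        r₀ = target + suc g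
        r₀<r : r₀ < r
        r₀<r = subst (r₀ <_) (sym r≡) ≤-refl
        r₀≤M : r₀ ≤ M
        r₀≤M = stuck⇒≤maxBlockers (proj₁ v) (below-stuck r₀<r) (filled (m<m+n target z<s) ≤-refl)
                                  (<⇒≤ r₀<r)

    room≤room-after-rest : ∀ {y} → y ∈ rest → room D y ≤ room after y
    room≤room-after-rest {a , b} y∈ with a <? r
    ... | yes a<r =
      ≤-trans (≤-reflexive (room-stuck≡0 (proj₁ v) (below-stuck a<r) (∈-remove⁻ D y∈))) z≤n
    ... | no  a≮r = room≤room-after-high {a} {b} (≮⇒≥ a≮r)

    totalRoom≡suc : totalRoom D ≡ suc (totalRoom after)
    totalRoom≡suc = ≤-antisym (begin
      totalRoom D                             ≡⟨ totalRoom-D≡ ⟩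
      room D source + sum (map (room D) rest) ≤⟨ +-mono-≤ room-source≤
                                                           (sum-map-mono {xs = rest} room≤room-after-rest) ⟩
      suc (totalRoom after)                   ∎) totalRoom-after<totalRoom
      where open ≤-Reasoning

-- Sequences of moves

≡⇒≋ : ∀ {D E} → D ≡ E → D ≋ E
≡⇒≋ refl _ = ⇔-id _

nontrivial-length≤totalRoom : ∀ {D} rs → ValidDiagram D → AllNontrivial D rs → length rs ≤ totalRoom D
nontrivial-length≤totalRoom []           _ _                   = z≤n
nontrivial-length≤totalRoom {D} (r ∷ rs) v (nontrivial , later) with fixed⊎moves D r
... | inj₁ (D≡ , _)    = contradiction (≡⇒≋ D≡) nontrivial
... | inj₂ (m , after≡) = begin
  suc (length rs)       ≤⟨ s≤s (nontrivial-length≤totalRoom rs after-valid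
                                 (subst (λ K → AllNontrivial K rs) after≡ later)) ⟩
  suc (totalRoom after) ≤⟨ totalRoom-after<totalRoom ⟩
  totalRoom D           ∎
  where
  open ≤-Reasoning
  open MoveAnalysis v m

row-bound : List Cell → ℕ
row-bound D = suc (foldr _⊔_ 0 (map proj₁ D))

move⇒<row-bound : ∀ {D r} → Move D r → r < row-bound D
move⇒<row-bound m = s≤s (≤-foldr-⊔ proj₁ (Move.source∈ m))

minimal⊎lowest-move : ∀ D → (∀ r → Fixed D r) ⊎ ∃[ r ] ((∀ {a} → a < r → Stuck D a) × Moves D r)
minimal⊎lowest-move D with lowest-or-all (fixed⊎moves D) (row-bound D)
... | inj₁ below = inj₁ (λ r → [ id , (λ (m , _) → below (move⇒<row-bound m)) ]′ (fixed⊎moves D r))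
... | inj₂ (r , below , move) = inj₂ (r , proj₂ ∘ below , move)

IsMinSequence-∷ : ∀ {D r rs} → ¬ (kohnert D r ≋ D) → IsMinSequence (kohnert D r) rs →
                  IsMinSequence D (r ∷ rs)
IsMinSequence-∷ nontrivial (later , minimal) = (nontrivial , later) , minimal

min-sequence-of-length : ∀ n {D} → ValidDiagram D → totalRoom D ≡ n →
                         ∃[ rs ] (IsMinSequence D rs × length rs ≡ n)
min-sequence-of-length n {D} v room≡n with minimal⊎lowest-move D
... | inj₁ minimal =
  [] , (tt , ≡⇒≋ ∘ proj₁ ∘ minimal) , trans (sym (totalRoom-stuck≡0 (proj₁ v) (proj₂ ∘ minimal))) room≡n
... | inj₂ (r , below , m , after≡) = prepend n room≡n
  where
  open MoveAnalysis v m
  open Lowest below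
  prepend : ∀ k → totalRoom D ≡ k → ∃[ rs ] (IsMinSequence D rs × length rs ≡ k)
  prepend zero    room≡0 = contradiction (subst (totalRoom after <_) room≡0 totalRoom-after<totalRoom) n≮0
  prepend (suc k) room≡k
    with min-sequence-of-length k after-valid (suc-injective (trans (sym totalRoom≡suc) room≡k))
  ... | rs , sequence , length≡ =
    r ∷ rs , IsMinSequence-∷ (subst (λ K → ¬ (K ≋ D)) (sym after≡) after≉D)
                              (subst (λ K → IsMinSequence K rs) (sym after≡) sequence)
           , cong suc length≡

theorem3p1 : (D : List Cell) → ValidDiagram D → IsMC D (sum (map (room D) D))
theorem3p1 D v = min-sequence-of-length _ v refl
               , λ rs sequence → nontrivial-length≤totalRoom rs v (proj₁ sequence)
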